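{- Let $k\in\mathbb{N}$ and $L\in\{\mathrm{FO}_k,\mathrm{MSO}_k\}$ with $\mathrm{Def}(L)\ne\emptyset$. Then $\mathrm{LS}(L)\le N_L$, $\mathrm{H}(L)\le N_L$, and consequently $\mathrm{DN}(L)\le N_L$.
   Context: Words are nonempty finite words over $\Sigma=\{l,r\}$, identified with word models (positions with linear order $<$ and unary predicates $P_l,P_r$). FO and MSO formulas are over $\{<,P_l,P_r\}$. Quantifier rank: $0$ for atomic formulas, unchanged by $\neg$, maximum over $\wedge,\vee$, each quantifier adds $1$. $\mathrm{FO}_k$ (resp. $\mathrm{MSO}_k$) is the set of FO (resp. MSO) formulas of quantifier rank at most $k$. $w\equiv_L v$ iff $w,v$ satisfy the same $L$-sentences; $N_L$ is the number of $\equiv_L$-classes on $\Sigma$-words. A sentence defines $w$ if $w$ is its only model; $\mathrm{Def}(L)$ is the set of $L$-definable words, $\mathrm{DN}(L)=\max\{|w|:w\in\mathrm{Def}(L)\}$. $\mu(\phi)$ is the minimal length of a model of $\phi$ ($0$ if none); $\nu(\phi)$ is the maximal length of a model of $\phi$ ($0$ if no models or arbitrarily long models). $\mathrm{LS}(L)=\max\{\mu(\phi):\phi\in L\}$, $\mathrm{H}(L)=\max\{\nu(\phi):\phi\in L\}$; these three numbers are defined for fragments $L$ with $\mathrm{Def}(L)\neq\emptyset$. -}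

module Defs where

open import Data.Nat using (ℕ; zero; suc; _≤_; _⊔_)
open import Data.Fin using (Fin)
import Data.Fin as Fin
open import Data.Bool using (Bool; true)
open import Data.List using (List; lookup)
open import Data.List.NonEmpty using (List⁺; toList)
import Data.List.NonEmpty as L⁺
open import Data.Vec using (Vec)
import Data.Vec as Vec
open import Data.Vec.Functional using (_∷_)
open import Data.Product using (Σ; ∃; _×_; _,_)
open import Data.Sum using (_⊎_)
open import Relation.Nullary using (¬_)
open import Relation.Binary.PropositionalEquality using (_≡_)
open import Function.Bundles using (_⇔_)

data Letter : Set where
  l r : Letter

Word : Set
Word = List⁺ Letter

len : Word → ℕ
len = L⁺.length

Pos : Word → Set
Pos w = Fin (Data.List.length (toList w))

letterAt : (w : Word) → Pos w → Letter
letterAt w i = lookup (toList w) i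

-- Formula L n m : n free first-order variables, m free set variables
-- (de Bruijn).

data Logic : Set where
  FO MSO : Logic

data Formula : Logic → ℕ → ℕ → Set where
  _≐_  : ∀ {L n m} → Fin n → Fin n → Formula L n m
  _≺_  : ∀ {L n m} → Fin n → Fin n → Formula L n m
  P    : ∀ {L n m} → Letter → Fin n → Formula L n m
  _∈S_ : ∀ {n m} → Fin n → Fin m → Formula MSO n m
  ¬f   : ∀ {L n m} → Formula L n m → Formula L n m
  _∧f_ : ∀ {L n m} → Formula L n m → Formula L n m → Formula L n m
  _∨f_ : ∀ {L n m} → Formula L n m → Formula L n m → Formula L n m
  ∃f   : ∀ {L n m} → Formula L (suc n) m → Formula L n m
  ∀f   : ∀ {L n m} → Formula L (suc n) m → Formula L n m
  ∃S   : ∀ {n m} → Formula MSO n (suc m) → Formula MSO n m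
  ∀S   : ∀ {n m} → Formula MSO n (suc m) → Formula MSO n m

rank : ∀ {L n m} → Formula L n m → ℕ
rank (x ≐ y)   = 0
rank (x ≺ y)   = 0
rank (P a x)   = 0
rank (x ∈S X)  = 0
rank (¬f φ)    = rank φ
rank (φ ∧f ψ)  = rank φ ⊔ rank ψ
rank (φ ∨f ψ)  = rank φ ⊔ rank ψ
rank (∃f φ)    = suc (rank φ)
rank (∀f φ)    = suc (rank φ)
rank (∃S φ)    = suc (rank φ)
rank (∀S φ)    = suc (rank φ)

Sat : ∀ {L n m} (w : Word) → Formula L n m →
      (Fin n → Pos w) → (Fin m → Pos w → Bool) → Set
Sat w (x ≐ y)  ρ σ = ρ x ≡ ρ y
Sat w (x ≺ y)  ρ σ = ρ x Fin.< ρ y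
Sat w (P a x)  ρ σ = letterAt w (ρ x) ≡ a
Sat w (x ∈S X) ρ σ = σ X (ρ x) ≡ true
Sat w (¬f φ)   ρ σ = ¬ Sat w φ ρ σ
Sat w (φ ∧f ψ) ρ σ = Sat w φ ρ σ × Sat w ψ ρ σ
Sat w (φ ∨f ψ) ρ σ = Sat w φ ρ σ ⊎ Sat w ψ ρ σ
Sat w (∃f φ)   ρ σ = Σ (Pos w) λ i → Sat w φ (i ∷ ρ) σ
Sat w (∀f φ)   ρ σ = (i : Pos w) → Sat w φ (i ∷ ρ) σ
Sat w (∃S φ)   ρ σ = Σ (Pos w → Bool) λ X → Sat w φ ρ (X ∷ σ)
Sat w (∀S φ)   ρ σ = (X : Pos w → Bool) → Sat w φ ρ (X ∷ σ)

Sentence : Logic → ℕ → Set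
Sentence L k = Σ (Formula L 0 0) λ φ → rank φ ≤ k

_⊨_ : Word → ∀ {L k} → Sentence L k → Set
w ⊨ (φ , _) = Sat w φ (λ ()) (λ ())

EquivL : Logic → ℕ → Word → Word → Set
EquivL L k w v = (φ : Sentence L k) → (w ⊨ φ) ⇔ (v ⊨ φ)

-- N_{L_k} = N : there is a system of N pairwise inequivalent
-- representatives covering all words (i.e. N is the number of classes).
NumClasses : Logic → ℕ → ℕ → Set
NumClasses L k N =
  Σ (Vec Word N) λ reps →
    ((i j : Fin N) → EquivL L k (Vec.lookup reps i) (Vec.lookup reps j) → i ≡ j)
    × ((w : Word) → ∃ λ i → EquivL L k w (Vec.lookup reps i))

Definable : Logic → ℕ → Word → Set
Definable L k w = Σ (Sentence L k) λ φ → (v : Word) → (v ⊨ φ) ⇔ (v ≡ w)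

DefNonEmpty : Logic → ℕ → Set
DefNonEmpty L k = ∃ λ w → Definable L k w

-- LS(L) ≤ N  ⇔  for every φ ∈ L, μ(φ) ≤ N  ⇔  every satisfiable φ ∈ L
-- has a model of length ≤ N.
LS≤ : Logic → ℕ → ℕ → Set
LS≤ L k N = (φ : Sentence L k) → (∃ λ w → w ⊨ φ) →
            ∃ λ w → (w ⊨ φ) × len w ≤ N

-- H(L) ≤ N  ⇔  for every φ ∈ L, ν(φ) ≤ N  ⇔  whenever the model lengths
-- of φ are bounded, every model of φ has length ≤ N.
H≤ : Logic → ℕ → ℕ → Set
H≤ L k N = (φ : Sentence L k) →
           (∃ λ B → (w : Word) → w ⊨ φ → len w ≤ B) →
           (w : Word) → w ⊨ φ → len w ≤ N

DN≤ : Logic → ℕ → ℕ → Set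
DN≤ L k N = (w : Word) → Definable L k w → len w ≤ N

-- For a fixed suffix z, a sentence of quantifier rank k about x ⁺++ z can be rewritten into a
-- sentence of rank at most k about x alone: a position of x ⁺++ z lies either in x or at one of
-- the finitely many positions of z, and a set of positions is determined by its trace on x
-- together with one of the finitely many subsets of z.  The alternatives living in z become
-- finite disjunctions and conjunctions, which cost no quantifier rank, so ≡ₖ is a right
-- congruence.  If len w > N, two of the N + 1 nonempty prefixes of w are ≡ₖ-equivalent, so
-- w = x y z with y nonempty and x ≡ₖ x y; then x z and every x yⁿ z are ≡ₖ w.  Deleting y
-- gives shorter models, pumping y arbitrarily long ones; this bounds LS and H, and DN ≤ H
-- because a defining sentence has a single model.

module Submission where

open import Defs
open import Data.Bool using (Bool; true; false)
import Data.Bool.Properties as Bool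
open import Data.Empty using (⊥-elim)
open import Data.Fin using (Fin; zero; suc; toℕ)
import Data.Fin as Fin
open import Data.Fin.Properties using (toℕ<n; pigeonhole)
open import Data.List using (List; []; _∷_; _++_; length; lookup; take; drop)
open import Data.List.NonEmpty using (_∷_; head; tail; toList; _⁺++_)
open import Data.List.Properties using (++-assoc; length-++; length-++-≤ʳ; take++drop≡id)
open import Data.Nat using (ℕ; zero; suc; _≤_; _<_; _⊔_; _+_; z≤n; s≤s; s≤s⁻¹; _≤?_)
open import Data.Nat.Induction using (<-wellFounded)
open import Data.Nat.Properties
  using ( ≤-refl; ≤-trans; ≤-reflexive; <-≤-trans; <-irrefl; <-asym; ≰⇒>; <⇒≱
        ; ⊔-lub; ⊔-mono-≤; m≤m+n; m<n+m; +-mono-≤; +-monoʳ-<; +-cancelˡ-< )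
open import Data.Product using (Σ; ∃; ∃₂; _×_; _,_; proj₁; proj₂) renaming (map to Σ-map)
open import Data.Product.Function.NonDependent.Propositional using (_×-⇔_)
open import Data.Sum using (_⊎_; inj₁; inj₂; [_,_])
import Data.Sum as Sum
open import Data.Sum.Function.Propositional using (_⊎-⇔_)
open import Data.Sum.Properties using (inj₁-injective; inj₂-injective)
open import Data.Vec using (Vec; []; tabulate)
import Data.Vec as Vec
open import Data.Vec.Functional using () renaming (_∷_ to _▹_)
open import Data.Vec.Properties using (lookup∘tabulate)
open import Function using (_∘_; const; id)
open import Function.Bundles using (_⇔_; mk⇔; Equivalence)
import Function.Properties.Equivalence as ⇔
open import Function.Related.TypeIsomorphisms using (¬-cong-⇔)
open import Induction.WellFounded using (Acc; acc)
open import Relation.Binary.Definitions using (DecidableEquality)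
open import Relation.Binary.PropositionalEquality
  using (_≡_; _≢_; refl; sym; trans; cong; subst; subst₂; module ≡-Reasoning)
open import Relation.Nullary using (¬_; Dec; yes; no)

open Equivalence using (to; from)

empty-⇔ : {A B : Set} → ¬ A → ¬ B → A ⇔ B
empty-⇔ ¬a ¬b = mk⇔ (⊥-elim ∘ ¬a) (⊥-elim ∘ ¬b)

≡-congˡ-⇔ : {A : Set} {a b c : A} → b ≡ c → (b ≡ a) ⇔ (c ≡ a)
≡-congˡ-⇔ b≡c = mk⇔ (trans (sym b≡c)) (trans b≡c)

module _ {A B C : Set} (R : A → B → C → Set)
         (cover : ∀ a → ∃₂ λ b c → R a b c) (cover⁻¹ : ∀ b c → ∃ λ a → R a b c)
         {P : A → Set} {Q : B → C → Set} (P⇔Q : ∀ {a b c} → R a b c → P a ⇔ Q b c) where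

  ∃-cong-cover : Σ A P ⇔ ∃₂ Q
  ∃-cong-cover = mk⇔ (λ (a , p) → forth (cover a) p) (λ (b , c , q) → back (cover⁻¹ b c) q)
    where
    forth : ∀ {a} → ∃₂ (R a) → P a → ∃₂ Q
    forth (b , c , R-abc) p = b , c , to (P⇔Q R-abc) p
    back : ∀ {b c} → ∃ (λ a → R a b c) → Q b c → Σ A P
    back (a , R-abc) q = a , from (P⇔Q R-abc) q

  ∀-cong-cover : (∀ a → P a) ⇔ (∀ b c → Q b c)
  ∀-cong-cover = mk⇔ (λ h b c → forth (cover⁻¹ b c) h) (λ h a → back (cover a) h)
    where
    forth : ∀ {b c} → ∃ (λ a → R a b c) → (∀ a → P a) → Q b c
    forth (a , R-abc) h = to (P⇔Q R-abc) (h a)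
    back : ∀ {a} → ∃₂ (R a) → (∀ b c → Q b c) → P a
    back (b , c , R-abc) h = from (P⇔Q R-abc) (h b c)

-- Positions in a concatenation

module _ {A : Set} where

  posˡ : ∀ (xs ys : List A) → Fin (length xs) → Fin (length (xs ++ ys))
  posˡ (_ ∷ xs) ys zero    = zero
  posˡ (_ ∷ xs) ys (suc i) = suc (posˡ xs ys i)

  posʳ : ∀ (xs ys : List A) → Fin (length ys) → Fin (length (xs ++ ys))
  posʳ []       ys j = j
  posʳ (_ ∷ xs) ys j = suc (posʳ xs ys j)

  split : ∀ (xs ys : List A) → Fin (length (xs ++ ys)) → Fin (length xs) ⊎ Fin (length ys)
  split []       ys p       = inj₂ p
  split (_ ∷ xs) ys zero    = inj₁ zero
  split (_ ∷ xs) ys (suc p) = Sum.map₁ suc (split xs ys p)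

  split-posˡ : ∀ xs ys i → split xs ys (posˡ xs ys i) ≡ inj₁ i
  split-posˡ (_ ∷ xs) ys zero    = refl
  split-posˡ (_ ∷ xs) ys (suc i) = cong (Sum.map₁ suc) (split-posˡ xs ys i)

  split-posʳ : ∀ xs ys j → split xs ys (posʳ xs ys j) ≡ inj₂ j
  split-posʳ []       ys j = refl
  split-posʳ (_ ∷ xs) ys j = cong (Sum.map₁ suc) (split-posʳ xs ys j)

  join-split : ∀ xs ys p → [ posˡ xs ys , posʳ xs ys ] (split xs ys p) ≡ p
  join-split []       ys p       = refl
  join-split (_ ∷ xs) ys zero    = refl
  join-split (_ ∷ xs) ys (suc p) with split xs ys p | join-split xs ys p
  ... | inj₁ i | eq = cong suc eq
  ... | inj₂ j | eq = cong suc eq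

  posˡ-injective : ∀ xs ys {i i′} → posˡ xs ys i ≡ posˡ xs ys i′ → i ≡ i′
  posˡ-injective xs ys {i} {i′} eq =
    inj₁-injective (trans (sym (split-posˡ xs ys i))
                          (trans (cong (split xs ys) eq) (split-posˡ xs ys i′)))

  posʳ-injective : ∀ xs ys {j j′} → posʳ xs ys j ≡ posʳ xs ys j′ → j ≡ j′
  posʳ-injective xs ys {j} {j′} eq =
    inj₂-injective (trans (sym (split-posʳ xs ys j))
                          (trans (cong (split xs ys) eq) (split-posʳ xs ys j′)))

  toℕ-posˡ : ∀ xs ys i → toℕ (posˡ xs ys i) ≡ toℕ i
  toℕ-posˡ (_ ∷ xs) ys zero    = refl
  toℕ-posˡ (_ ∷ xs) ys (suc i) = cong suc (toℕ-posˡ xs ys i)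

  toℕ-posʳ : ∀ xs ys j → toℕ (posʳ xs ys j) ≡ length xs + toℕ j
  toℕ-posʳ []       ys j = refl
  toℕ-posʳ (_ ∷ xs) ys j = cong suc (toℕ-posʳ xs ys j)

  posˡ<posʳ : ∀ xs ys i j → posˡ xs ys i Fin.< posʳ xs ys j
  posˡ<posʳ xs ys i j = subst₂ _<_ (sym (toℕ-posˡ xs ys i)) (sym (toℕ-posʳ xs ys j))
                          (<-≤-trans (toℕ<n i) (m≤m+n (length xs) (toℕ j)))

  posˡ≢posʳ : ∀ xs ys {i j} → posˡ xs ys i ≢ posʳ xs ys j
  posˡ≢posʳ xs ys {i} {j} eq = <-irrefl (cong toℕ eq) (posˡ<posʳ xs ys i j)

  posˡ-<-⇔ : ∀ xs ys i i′ → (posˡ xs ys i Fin.< posˡ xs ys i′) ⇔ (i Fin.< i′)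
  posˡ-<-⇔ xs ys i i′ = mk⇔ (subst₂ _<_ (toℕ-posˡ xs ys i) (toℕ-posˡ xs ys i′))
                            (subst₂ _<_ (sym (toℕ-posˡ xs ys i)) (sym (toℕ-posˡ xs ys i′)))

  posʳ-<-⇔ : ∀ xs ys j j′ → (posʳ xs ys j Fin.< posʳ xs ys j′) ⇔ (j Fin.< j′)
  posʳ-<-⇔ xs ys j j′ = mk⇔
    (λ lt → +-cancelˡ-< (length xs) _ _ (subst₂ _<_ (toℕ-posʳ xs ys j) (toℕ-posʳ xs ys j′) lt))
    (λ lt → subst₂ _<_ (sym (toℕ-posʳ xs ys j)) (sym (toℕ-posʳ xs ys j′))
                       (+-monoʳ-< (length xs) lt))

  lookup-posˡ : ∀ xs ys i → lookup (xs ++ ys) (posˡ xs ys i) ≡ lookup xs i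
  lookup-posˡ (_ ∷ xs) ys zero    = refl
  lookup-posˡ (_ ∷ xs) ys (suc i) = lookup-posˡ xs ys i

  lookup-posʳ : ∀ xs ys j → lookup (xs ++ ys) (posʳ xs ys j) ≡ lookup ys j
  lookup-posʳ []       ys j = refl
  lookup-posʳ (_ ∷ xs) ys j = lookup-posʳ xs ys j

module _ {L : Logic} {n m : ℕ} where

  -- The signature has no truth constants, so these mention a variable.
  ⊤ᶠ ⊥ᶠ : Fin n → Formula L n m
  ⊤ᶠ u = u ≐ u
  ⊥ᶠ u = ¬f (u ≐ u)

  decided : {A : Set} → Dec A → Fin n → Formula L n m
  decided (yes _) = ⊤ᶠ
  decided (no _)  = ⊥ᶠ

  fold⁺ : ∀ {k} → (Formula L n m → Formula L n m → Formula L n m) →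
          (Fin (suc k) → Formula L n m) → Formula L n m
  fold⁺ {zero}  _⊕_ F = F zero
  fold⁺ {suc k} _⊕_ F = F zero ⊕ fold⁺ _⊕_ (F ∘ suc)

  foldᵛ : (Formula L n m → Formula L n m → Formula L n m) →
          ∀ d → (Vec Bool d → Formula L n m) → Formula L n m
  foldᵛ _⊕_ zero    F = F []
  foldᵛ _⊕_ (suc d) F = foldᵛ _⊕_ d (F ∘ (false Vec.∷_)) ⊕ foldᵛ _⊕_ d (F ∘ (true Vec.∷_))

  ⋁ ⋀ : ∀ {k} → (Fin (suc k) → Formula L n m) → Formula L n m
  ⋁ = fold⁺ _∨f_
  ⋀ = fold⁺ _∧f_

  ⋁ᵛ ⋀ᵛ : ∀ d → (Vec Bool d → Formula L n m) → Formula L n m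
  ⋁ᵛ = foldᵛ _∨f_
  ⋀ᵛ = foldᵛ _∧f_

  rank-decided : {A : Set} (D : Dec A) (u : Fin n) → rank (decided D u) ≡ 0
  rank-decided (yes _) u = refl
  rank-decided (no _)  u = refl

  module _ {_⊕_ : Formula L n m → Formula L n m → Formula L n m}
           (rank-⊕ : ∀ φ ψ → rank (φ ⊕ ψ) ≤ rank φ ⊔ rank ψ) {r : ℕ} where

    rank-fold⁺ : ∀ {k} {F : Fin (suc k) → Formula L n m} →
                 (∀ i → rank (F i) ≤ r) → rank (fold⁺ _⊕_ F) ≤ r
    rank-fold⁺ {zero}  bound = bound zero
    rank-fold⁺ {suc k} {F} bound =
      ≤-trans (rank-⊕ (F zero) _) (⊔-lub (bound zero) (rank-fold⁺ (bound ∘ suc)))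

    rank-foldᵛ : ∀ d {F : Vec Bool d → Formula L n m} →
                 (∀ t → rank (F t) ≤ r) → rank (foldᵛ _⊕_ d F) ≤ r
    rank-foldᵛ zero    bound = bound []
    rank-foldᵛ (suc d) bound =
      ≤-trans (rank-⊕ _ _) (⊔-lub (rank-foldᵛ d (bound ∘ (false Vec.∷_)))
                                  (rank-foldᵛ d (bound ∘ (true Vec.∷_))))

  module _ {w : Word} {ρ : Fin n → Pos w} {σ : Fin m → Pos w → Bool} where

    Sat-⊥ᶠ : ∀ u → ¬ Sat w (⊥ᶠ u) ρ σ
    Sat-⊥ᶠ u ¬refl = ¬refl refl

    Sat-decided : {A : Set} (D : Dec A) (u : Fin n) → Sat w (decided D u) ρ σ ⇔ A
    Sat-decided (yes a) u = mk⇔ (const a) (const refl)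
    Sat-decided (no ¬a) u = empty-⇔ (Sat-⊥ᶠ u) ¬a

    Sat-⋁ : ∀ {k} (F : Fin (suc k) → Formula L n m) → Sat w (⋁ F) ρ σ ⇔ ∃ λ i → Sat w (F i) ρ σ
    Sat-⋁ {zero}  F = mk⇔ (zero ,_) λ { (zero , p) → p }
    Sat-⋁ {suc k} F = mk⇔
      (λ { (inj₁ p) → zero , p ; (inj₂ q) → Σ-map suc id (to (Sat-⋁ (F ∘ suc)) q) })
      (λ { (zero , p) → inj₁ p ; (suc i , p) → inj₂ (from (Sat-⋁ (F ∘ suc)) (i , p)) })

    Sat-⋀ : ∀ {k} (F : Fin (suc k) → Formula L n m) → Sat w (⋀ F) ρ σ ⇔ (∀ i → Sat w (F i) ρ σ)
    Sat-⋀ {zero}  F = mk⇔ (λ p → λ { zero → p }) (λ h → h zero)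
    Sat-⋀ {suc k} F = mk⇔
      (λ (p , q) → λ { zero → p ; (suc i) → to (Sat-⋀ (F ∘ suc)) q i })
      (λ h → h zero , from (Sat-⋀ (F ∘ suc)) (h ∘ suc))

    Sat-⋁ᵛ : ∀ d (F : Vec Bool d → Formula L n m) → Sat w (⋁ᵛ d F) ρ σ ⇔ ∃ λ t → Sat w (F t) ρ σ
    Sat-⋁ᵛ zero    F = mk⇔ ([] ,_) λ { ([] , p) → p }
    Sat-⋁ᵛ (suc d) F = mk⇔
      (λ { (inj₁ p) → Σ-map (false Vec.∷_) id (to (Sat-⋁ᵛ d _) p)
         ; (inj₂ p) → Σ-map (true Vec.∷_) id (to (Sat-⋁ᵛ d _) p) })
      (λ { (false Vec.∷ t , p) → inj₁ (from (Sat-⋁ᵛ d _) (t , p))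
         ; (true Vec.∷ t , p) → inj₂ (from (Sat-⋁ᵛ d _) (t , p)) })

    Sat-⋀ᵛ : ∀ d (F : Vec Bool d → Formula L n m) → Sat w (⋀ᵛ d F) ρ σ ⇔ (∀ t → Sat w (F t) ρ σ)
    Sat-⋀ᵛ zero    F = mk⇔ (λ p → λ { [] → p }) (λ h → h [])
    Sat-⋀ᵛ (suc d) F = mk⇔
      (λ (p , q) → λ { (false Vec.∷ t) → to (Sat-⋀ᵛ d _) p t
                     ; (true Vec.∷ t)  → to (Sat-⋀ᵛ d _) q t })
      (λ h → from (Sat-⋀ᵛ d _) (h ∘ (false Vec.∷_)) , from (Sat-⋀ᵛ d _) (h ∘ (true Vec.∷_)))

_≟ᴸ_ : DecidableEquality Letter
l ≟ᴸ l = yes refl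
l ≟ᴸ r = no λ ()
r ≟ᴸ l = no λ ()
r ≟ᴸ r = yes refl

-- Eliminating a fixed suffix

module StripSuffix (z : List Letter) where

  -- Where a variable lives: zero means in the prefix, whose assignment then gives the position;
  -- suc j means position j of z.
  Loc : Set
  Loc = Fin (suc (length z))

  strip-≐ strip-≺ : ∀ {L n m} → Loc → Loc → Fin n → Fin n → Formula L n m
  strip-≐ zero    zero    u v = u ≐ v
  strip-≐ zero    (suc _) u v = ⊥ᶠ u
  strip-≐ (suc _) zero    u v = ⊥ᶠ u
  strip-≐ (suc i) (suc j) u v = decided (i Fin.≟ j) u

  strip-≺ zero    zero    u v = u ≺ v
  strip-≺ zero    (suc _) u v = ⊤ᶠ u
  strip-≺ (suc _) zero    u v = ⊥ᶠ u
  strip-≺ (suc i) (suc j) u v = decided (i Fin.<? j) u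

  strip-P : ∀ {L n m} → Letter → Loc → Fin n → Formula L n m
  strip-P a zero    u = P a u
  strip-P a (suc j) u = decided (lookup z j ≟ᴸ a) u

  strip-∈ : ∀ {n m} → Loc → Vec Bool (length z) → Fin n → Fin m → Formula MSO n m
  strip-∈ zero    t u X = u ∈S X
  strip-∈ (suc j) t u X = decided (Vec.lookup t j Bool.≟ true) u

  -- s gives the traces on z of the set variables, as vectors rather than functions so that
  -- they can be enumerated without function extensionality.
  strip : ∀ {L n m} → (Fin n → Loc) → (Fin m → Vec Bool (length z)) → Formula L n m → Formula L n m
  strip c s (u ≐ v)  = strip-≐ (c u) (c v) u v
  strip c s (u ≺ v)  = strip-≺ (c u) (c v) u v
  strip c s (P a u)  = strip-P a (c u) u
  strip c s (u ∈S X) = strip-∈ (c u) (s X) u X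
  strip c s (¬f φ)   = ¬f (strip c s φ)
  strip c s (φ ∧f ψ) = strip c s φ ∧f strip c s ψ
  strip c s (φ ∨f ψ) = strip c s φ ∨f strip c s ψ
  -- For ℓ in z the prefix quantifier is vacuous; keeping it spares removing a de Bruijn index
  -- and costs no more rank than ∃f φ itself.
  strip c s (∃f φ)   = ⋁ λ ℓ → ∃f (strip (ℓ ▹ c) s φ)
  strip c s (∀f φ)   = ⋀ λ ℓ → ∀f (strip (ℓ ▹ c) s φ)
  strip c s (∃S φ)   = ⋁ᵛ _ λ t → ∃S (strip c (t ▹ s) φ)
  strip c s (∀S φ)   = ⋀ᵛ _ λ t → ∀S (strip c (t ▹ s) φ)

  rank-strip : ∀ {L n m} c s (φ : Formula L n m) → rank (strip c s φ) ≤ rank φ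
  rank-strip c s (u ≐ v) with c u | c v
  ... | zero  | zero  = z≤n
  ... | zero  | suc _ = z≤n
  ... | suc _ | zero  = z≤n
  ... | suc i | suc j = ≤-reflexive (rank-decided (i Fin.≟ j) u)
  rank-strip c s (u ≺ v) with c u | c v
  ... | zero  | zero  = z≤n
  ... | zero  | suc _ = z≤n
  ... | suc _ | zero  = z≤n
  ... | suc i | suc j = ≤-reflexive (rank-decided (i Fin.<? j) u)
  rank-strip c s (P a u) with c u
  ... | zero  = z≤n
  ... | suc j = ≤-reflexive (rank-decided (lookup z j ≟ᴸ a) u)
  rank-strip c s (u ∈S X) with c u
  ... | zero  = z≤n
  ... | suc j = ≤-reflexive (rank-decided (Vec.lookup (s X) j Bool.≟ true) u)
  rank-strip c s (¬f φ)   = rank-strip c s φ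
  rank-strip c s (φ ∧f ψ) = ⊔-mono-≤ (rank-strip c s φ) (rank-strip c s ψ)
  rank-strip c s (φ ∨f ψ) = ⊔-mono-≤ (rank-strip c s φ) (rank-strip c s ψ)
  rank-strip c s (∃f φ)   = rank-fold⁺ (λ _ _ → ≤-refl) λ ℓ → s≤s (rank-strip (ℓ ▹ c) s φ)
  rank-strip c s (∀f φ)   = rank-fold⁺ (λ _ _ → ≤-refl) λ ℓ → s≤s (rank-strip (ℓ ▹ c) s φ)
  rank-strip c s (∃S φ)   = rank-foldᵛ (λ _ _ → ≤-refl) _ λ t → s≤s (rank-strip c (t ▹ s) φ)
  rank-strip c s (∀S φ)   = rank-foldᵛ (λ _ _ → ≤-refl) _ λ t → s≤s (rank-strip c (t ▹ s) φ)

module _ (x : Word) (z : List Letter) where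
  open StripSuffix z

  private
    xs = toList x
    xz = x ⁺++ z

  position : Loc → Pos x → Pos xz
  position zero    i = posˡ xs z i
  position (suc j) _ = posʳ xs z j

  record Splits (Y : Pos xz → Bool) (t : Vec Bool (length z)) (Yx : Pos x → Bool) : Set where
    field
      onˡ : ∀ i → Y (posˡ xs z i) ≡ Yx i
      onʳ : ∀ j → Y (posʳ xs z j) ≡ Vec.lookup t j
  open Splits

  record Agree {n m} (c : Fin n → Loc) (s : Fin m → Vec Bool (length z))
               (ρ : Fin n → Pos xz) (σ : Fin m → Pos xz → Bool)
               (ρx : Fin n → Pos x) (σx : Fin m → Pos x → Bool) : Set where
    field
      vars : ∀ u → ρ u ≡ position (c u) (ρx u)
      sets : ∀ X → Splits (σ X) (s X) (σx X)
  open Agree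

  pos-cover : ∀ p → ∃₂ λ ℓ i → p ≡ position ℓ i
  pos-cover p with split xs z p | join-split xs z p
  ... | inj₁ i | eq = zero , i , sym eq
  ... | inj₂ j | eq = suc j , zero , sym eq

  set-cover : ∀ Y → ∃₂ λ t Yx → Splits Y t Yx
  set-cover Y = tabulate (Y ∘ posʳ xs z) , Y ∘ posˡ xs z
              , record { onˡ = λ _ → refl ; onʳ = λ j → sym (lookup∘tabulate _ j) }

  set-cover⁻¹ : ∀ t Yx → ∃ λ Y → Splits Y t Yx
  set-cover⁻¹ t Yx = [ Yx , Vec.lookup t ] ∘ split xs z , record
    { onˡ = λ i → cong [ Yx , Vec.lookup t ] (split-posˡ xs z i)
    ; onʳ = λ j → cong [ Yx , Vec.lookup t ] (split-posʳ xs z j) }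

  module _ {n m : ℕ} {c : Fin n → Loc} {s : Fin m → Vec Bool (length z)}
           {ρ : Fin n → Pos xz} {σ : Fin m → Pos xz → Bool}
           {ρx : Fin n → Pos x} {σx : Fin m → Pos x → Bool} where

    Agree-▹ᵖ : ∀ {p ℓ i} → Agree c s ρ σ ρx σx → p ≡ position ℓ i →
               Agree (ℓ ▹ c) s (p ▹ ρ) σ (i ▹ ρx) σx
    Agree-▹ᵖ ag eq = record { vars = λ { zero → eq ; (suc u) → vars ag u } ; sets = sets ag }

    Agree-▹ˢ : ∀ {Y t Yx} → Agree c s ρ σ ρx σx → Splits Y t Yx →
               Agree c (t ▹ s) ρ (Y ▹ σ) ρx (Yx ▹ σx)
    Agree-▹ˢ ag sp = record { vars = vars ag ; sets = λ { zero → sp ; (suc X) → sets ag X } }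

  module _ {n m : ℕ} (ρx : Fin n → Pos x) (σx : Fin m → Pos x → Bool) where

    private
      decides : ∀ {L A} (D : Dec A) u → A ⇔ Sat x (decided {L} D u) ρx σx
      decides D u = ⇔.sym (Sat-decided D u)

      refutes : ∀ {L A} → ¬ A → ∀ u → A ⇔ Sat x (⊥ᶠ {L} u) ρx σx
      refutes {L} ¬a u = empty-⇔ ¬a (Sat-⊥ᶠ {L} {w = x} {ρ = ρx} {σ = σx} u)

    Sat-strip-≐ : ∀ {L} u v ℓ ℓ′ →
                  (position ℓ (ρx u) ≡ position ℓ′ (ρx v)) ⇔ Sat x (strip-≐ {L} ℓ ℓ′ u v) ρx σx
    Sat-strip-≐     u v zero    zero    = mk⇔ (posˡ-injective xs z) (cong (posˡ xs z))
    Sat-strip-≐ {L} u v zero    (suc j) = refutes {L} (posˡ≢posʳ xs z) u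
    Sat-strip-≐ {L} u v (suc i) zero    = refutes {L} (posˡ≢posʳ xs z ∘ sym) u
    Sat-strip-≐     u v (suc i) (suc j) =
      ⇔.trans (mk⇔ (posʳ-injective xs z) (cong (posʳ xs z))) (decides (i Fin.≟ j) u)

    Sat-strip-≺ : ∀ {L} u v ℓ ℓ′ →
                  (position ℓ (ρx u) Fin.< position ℓ′ (ρx v)) ⇔ Sat x (strip-≺ {L} ℓ ℓ′ u v) ρx σx
    Sat-strip-≺     u v zero    zero    = posˡ-<-⇔ xs z (ρx u) (ρx v)
    Sat-strip-≺     u v zero    (suc j) = mk⇔ (const refl) (const (posˡ<posʳ xs z (ρx u) j))
    Sat-strip-≺ {L} u v (suc i) zero    = refutes {L} (<-asym (posˡ<posʳ xs z (ρx v) i)) u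
    Sat-strip-≺     u v (suc i) (suc j) = ⇔.trans (posʳ-<-⇔ xs z i j) (decides (i Fin.<? j) u)

    Sat-strip-P : ∀ {L} a u ℓ →
                  (lookup (xs ++ z) (position ℓ (ρx u)) ≡ a) ⇔ Sat x (strip-P {L} a ℓ u) ρx σx
    Sat-strip-P a u zero    = ≡-congˡ-⇔ (lookup-posˡ xs z (ρx u))
    Sat-strip-P a u (suc j) = ⇔.trans (≡-congˡ-⇔ (lookup-posʳ xs z j)) (decides (lookup z j ≟ᴸ a) u)

    Sat-strip-∈ : ∀ {Y t} u X ℓ → Splits Y t (σx X) →
                  (Y (position ℓ (ρx u)) ≡ true) ⇔ Sat x (strip-∈ ℓ t u X) ρx σx
    Sat-strip-∈ u X zero    sp = ≡-congˡ-⇔ (onˡ sp (ρx u))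
    Sat-strip-∈ {t = t} u X (suc j) sp =
      ⇔.trans (≡-congˡ-⇔ (onʳ sp j)) (decides (Vec.lookup t j Bool.≟ true) u)

  Sat-strip : ∀ {L n m} (φ : Formula L n m) {c s ρ σ ρx σx} → Agree c s ρ σ ρx σx →
              Sat xz φ ρ σ ⇔ Sat x (strip c s φ) ρx σx
  Sat-strip (u ≐ v) {c} {ρx = ρx} {σx} ag rewrite vars ag u | vars ag v =
    Sat-strip-≐ ρx σx u v (c u) (c v)
  Sat-strip (u ≺ v) {c} {ρx = ρx} {σx} ag rewrite vars ag u | vars ag v =
    Sat-strip-≺ ρx σx u v (c u) (c v)
  Sat-strip (P a u) {c} {ρx = ρx} {σx} ag rewrite vars ag u =
    Sat-strip-P ρx σx a u (c u)
  Sat-strip (u ∈S X) {c} {ρx = ρx} {σx} ag rewrite vars ag u =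
    Sat-strip-∈ ρx σx u X (c u) (sets ag X)
  Sat-strip (¬f φ)   ag = ¬-cong-⇔ (Sat-strip φ ag)
  Sat-strip (φ ∧f ψ) ag = Sat-strip φ ag ×-⇔ Sat-strip ψ ag
  Sat-strip (φ ∨f ψ) ag = Sat-strip φ ag ⊎-⇔ Sat-strip ψ ag
  Sat-strip (∃f φ)   ag = ⇔.trans
    (∃-cong-cover (λ p ℓ i → p ≡ position ℓ i) pos-cover (λ ℓ i → position ℓ i , refl)
      (λ eq → Sat-strip φ (Agree-▹ᵖ ag eq)))
    (⇔.sym (Sat-⋁ _))
  Sat-strip (∀f φ)   ag = ⇔.trans
    (∀-cong-cover (λ p ℓ i → p ≡ position ℓ i) pos-cover (λ ℓ i → position ℓ i , refl)
      (λ eq → Sat-strip φ (Agree-▹ᵖ ag eq)))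
    (⇔.sym (Sat-⋀ _))
  Sat-strip (∃S φ)   ag = ⇔.trans
    (∃-cong-cover Splits set-cover set-cover⁻¹ (λ sp → Sat-strip φ (Agree-▹ˢ ag sp)))
    (⇔.sym (Sat-⋁ᵛ _ _))
  Sat-strip (∀S φ)   ag = ⇔.trans
    (∀-cong-cover Splits set-cover set-cover⁻¹ (λ sp → Sat-strip φ (Agree-▹ˢ ag sp)))
    (⇔.sym (Sat-⋀ᵛ _ _))

-- ≡ₖ is a right congruence

module _ {L : Logic} {k : ℕ} where

  EquivL-sym : ∀ {u v} → EquivL L k u v → EquivL L k v u
  EquivL-sym u≈v φ = ⇔.sym (u≈v φ)

  EquivL-trans : ∀ {u v w} → EquivL L k u v → EquivL L k v w → EquivL L k u w
  EquivL-trans u≈v v≈w φ = ⇔.trans (u≈v φ) (v≈w φ)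

  ≡⇒EquivL : ∀ {u v} → u ≡ v → EquivL L k u v
  ≡⇒EquivL refl φ = ⇔.refl

  ⁺++-congʳ : ∀ {u v} z → EquivL L k u v → EquivL L k (u ⁺++ z) (v ⁺++ z)
  ⁺++-congʳ {u} {v} z u≈v (φ , rank≤k) =
    ⇔.trans (Sat-strip u z φ no-variables)
      (⇔.trans (u≈v (strip (λ ()) (λ ()) φ , ≤-trans (rank-strip (λ ()) (λ ()) φ) rank≤k))
        (⇔.sym (Sat-strip v z φ no-variables)))
    where
    open StripSuffix z
    no-variables : ∀ {w} → Agree w z (λ ()) (λ ()) (λ ()) (λ ()) (λ ()) (λ ())
    no-variables = record { vars = λ () ; sets = λ () }

-- Pumping

take-extends : ∀ {A : Set} (as : List A) {i j} → i < j → j ≤ length as →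
               ∃ λ y → take j as ≡ take i as ++ y × 0 < length y
take-extends (a ∷ as) {zero}  {suc j} _         _         = a ∷ take j as , refl , s≤s z≤n
take-extends (a ∷ as) {suc i} {suc j} (s≤s i<j) (s≤s j≤n) =
  let (y , eq , y≢[]) = take-extends as i<j j≤n in y , cong (a ∷_) eq , y≢[]

len-⁺++ : ∀ (x : Word) t → len (x ⁺++ t) ≡ len x + length t
len-⁺++ x t = cong suc (length-++ (tail x))

⁺++-++ : ∀ (x : Word) y z → (x ⁺++ y) ⁺++ z ≡ x ⁺++ (y ++ z)
⁺++-++ x y z = cong (head x ∷_) (++-assoc (tail x) y z)

prefix : Word → ℕ → Word
prefix w j = head w ∷ take j (tail w)

record Loop (L : Logic) (k : ℕ) (w : Word) : Set where
  field
    x        : Word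
    y z      : List Letter
    y≢[]     : 0 < length y
    x≈xy     : EquivL L k x (x ⁺++ y)
    w≡xyz    : w ≡ x ⁺++ (y ++ z)

same-class⇒EquivL : ∀ {L k N} (reps : Vec Word N)
                    (classify : ∀ w → ∃ λ i → EquivL L k w (Vec.lookup reps i)) {u v} →
                    proj₁ (classify u) ≡ proj₁ (classify v) → EquivL L k u v
same-class⇒EquivL {L} {k} reps classify {u} {v} eq = EquivL-trans (proj₂ (classify u))
  (EquivL-sym (subst (λ c → EquivL L k v (Vec.lookup reps c)) (sym eq) (proj₂ (classify v))))

long⇒Loop : ∀ {L k N} → NumClasses L k N → ∀ w → N < len w → Loop L k w
long⇒Loop (reps , _ , classify) w N<len
  with i , j , i<j , same ← pigeonhole N<len (proj₁ ∘ classify ∘ prefix w ∘ toℕ)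
  with y , take-j≡ , y≢[] ← take-extends (tail w) i<j (s≤s⁻¹ (toℕ<n j)) = record
  { x       = prefix w (toℕ i)
  ; y       = y
  ; z       = drop (toℕ j) (tail w)
  ; y≢[]    = y≢[]
  ; x≈xy    = EquivL-trans (same-class⇒EquivL reps classify same)
                           (≡⇒EquivL (cong (head w ∷_) take-j≡))
  ; w≡xyz   = cong (head w ∷_) (begin
      tail w                                   ≡⟨ take++drop≡id (toℕ j) (tail w) ⟨
      take (toℕ j) (tail w) ++ drop (toℕ j) _  ≡⟨ cong (_++ _) take-j≡ ⟩
      (take (toℕ i) (tail w) ++ y) ++ _        ≡⟨ ++-assoc (take (toℕ i) (tail w)) y _ ⟩
      take (toℕ i) (tail w) ++ y ++ _          ∎)
  }
  where open ≡-Reasoning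

⊨-resp-EquivL : ∀ {L k u v} (φ : Sentence L k) → EquivL L k u v → u ⊨ φ → v ⊨ φ
⊨-resp-EquivL φ u≈v = to (u≈v φ)

module _ {L : Logic} {k : ℕ} {w : Word} (loop : Loop L k w) where
  open Loop loop

  pumped : ℕ → List Letter
  pumped zero    = z
  pumped (suc n) = y ++ pumped n

  pumped-EquivL : ∀ n → EquivL L k (x ⁺++ z) (x ⁺++ pumped n)
  pumped-EquivL zero    = ≡⇒EquivL refl
  pumped-EquivL (suc n) = EquivL-trans (pumped-EquivL n)
    (EquivL-trans (⁺++-congʳ (pumped n) x≈xy) (≡⇒EquivL (⁺++-++ x y (pumped n))))

  pumped-model : ∀ φ → w ⊨ φ → ∀ n → (x ⁺++ pumped n) ⊨ φ
  pumped-model φ w⊨φ n = ⊨-resp-EquivL φ (pumped-EquivL n)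
    (⊨-resp-EquivL φ (EquivL-sym (pumped-EquivL 1)) (subst (_⊨ φ) w≡xyz w⊨φ))

  shorter : len (x ⁺++ z) < len w
  shorter rewrite w≡xyz | len-⁺++ x z | len-⁺++ x (y ++ z) | length-++ y {z} =
    +-monoʳ-< (len x) (m<n+m (length z) y≢[])

  longer : ∀ n → n < len (x ⁺++ pumped n)
  longer n = s≤s (≤-trans (n≤length n) (length-++-≤ʳ (pumped n) {tail x}))
    where
    n≤length : ∀ n → n ≤ length (pumped n)
    n≤length zero    = z≤n
    n≤length (suc n) = subst (suc n ≤_) (sym (length-++ y)) (+-mono-≤ y≢[] (n≤length n))

module _ {L : Logic} {k N : ℕ} (classes : NumClasses L k N) where

  NumClasses⇒LS≤ : LS≤ L k N
  NumClasses⇒LS≤ φ (w , w⊨φ) = go w (<-wellFounded (len w)) w⊨φ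
    where
    go : ∀ w → Acc _<_ (len w) → w ⊨ φ → ∃ λ v → (v ⊨ φ) × len v ≤ N
    go w (acc smaller) w⊨φ with len w ≤? N
    ... | yes short = w , w⊨φ , short
    ... | no long   = go _ (smaller (shorter loop)) (pumped-model loop φ w⊨φ 0)
      where
      loop : Loop L k w
      loop = long⇒Loop classes w (≰⇒> long)

  NumClasses⇒H≤ : H≤ L k N
  NumClasses⇒H≤ φ (B , bounded) w w⊨φ with len w ≤? N
  ... | yes short = short
  ... | no long   = ⊥-elim (<⇒≱ (longer loop B) (bounded _ (pumped-model loop φ w⊨φ B)))
    where
    loop : Loop L k w
    loop = long⇒Loop classes w (≰⇒> long)

  NumClasses⇒DN≤ : DN≤ L k N
  NumClasses⇒DN≤ w (φ , defines) =
    NumClasses⇒H≤ φ (len w , λ v v⊨φ → ≤-reflexive (cong len (to (defines v) v⊨φ)))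
                  w (from (defines w) refl)

corollary1 : (k : ℕ) (L : Logic) (N : ℕ) → NumClasses L k N →
    DefNonEmpty L k → LS≤ L k N × H≤ L k N × DN≤ L k N
-- DefNonEmpty only makes the paper's LS, H and DN well defined; the bounds do not need it.
corollary1 k L N classes _ =
  NumClasses⇒LS≤ classes , NumClasses⇒H≤ classes , NumClasses⇒DN≤ classes
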